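{- Let $n\ge 2$ and let $G_1,\dots,G_n$ be simple graphs. Then $\bar{\gamma}_p(G_1\vee G_2\vee\cdots\vee G_n)=0$ if and only if for each $i=1,\dots,n$, either $\bar{\gamma}_p(G_i)=0$ or $G_i=\overline{K_2}$.
   Context: The join $G\vee H$ has vertex set $V(G)\cup V(H)$ and edge set $E(G)\cup E(H)\cup\{\{u,v\}:u\in V(G),v\in V(H)\}$. $\overline{K_2}$ is the graph on two vertices with no edge. For $v\in V$, $N[v]$ is the closed neighborhood; for $S\subseteq V$, $N[S]=\bigcup_{v\in S}N[v]$. Define $\mathcal{P}^0(S)=N[S]$, $\mathcal{P}^{i+1}(S)=\mathcal{P}^i(S)\cup\{w : \{w\}=N[v]\setminus\mathcal{P}^i(S)\text{ for some } v\in\mathcal{P}^i(S)\}$, with eventual value $\mathcal{P}^\infty(S)$. $S$ is a power dominating set (PDS) if $\mathcal{P}^\infty(S)=V$, and a failed power dominating set (FPDS) otherwise. $\bar{\gamma}_p(G)$ is the maximum cardinality of an FPDS of $G$. -}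

module Defs where

open import Data.Nat using (ℕ; zero; suc; _+_; _≤_)
open import Data.Bool using (Bool; true; false)
open import Data.Fin using (Fin; splitAt)
import Data.Fin as F
open import Data.Fin.Subset using (Subset; _∈_; _∉_; ∣_∣)
open import Data.Sum using (_⊎_; inj₁; inj₂)
open import Data.Product using (Σ; ∃; ∃-syntax; _×_; _,_)
open import Relation.Nullary using (¬_)
open import Relation.Binary.PropositionalEquality using (_≡_; refl)

record Graph : Set where
  field
    order  : ℕ
    adj    : Fin order → Fin order → Bool
    sym    : ∀ u v → adj u v ≡ adj v u
    irrefl : ∀ v → adj v v ≡ false
open Graph public

Vertex : Graph → Set
Vertex G = Fin (order G)

Adj : (G : Graph) → Vertex G → Vertex G → Set
Adj G u v = adj G u v ≡ true

InClosedNbhd : (G : Graph) → Vertex G → Vertex G → Set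
InClosedNbhd G v u = u ≡ v ⊎ Adj G v u

InNbhdSet : (G : Graph) → Subset (order G) → Vertex G → Set
InNbhdSet G S u = ∃[ v ] (v ∈ S × InClosedNbhd G v u)

InP : (G : Graph) → Subset (order G) → ℕ → Vertex G → Set
InP G S zero    w = InNbhdSet G S w
InP G S (suc i) w =
  InP G S i w ⊎
  (∃[ v ] (InP G S i v ×
           -- {w} = N[v] \ P^i(S)
           (InClosedNbhd G v w × ¬ InP G S i w) ×
           (∀ u → InClosedNbhd G v u → ¬ InP G S i u → u ≡ w)))

InPinf : (G : Graph) → Subset (order G) → Vertex G → Set
InPinf G S w = ∃[ i ] InP G S i w

IsPDS : (G : Graph) → Subset (order G) → Set
IsPDS G S = ∀ w → InPinf G S w

IsFPDS : (G : Graph) → Subset (order G) → Set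
IsFPDS G S = ¬ IsPDS G S

FPDSNumber : Graph → ℕ → Set
FPDSNumber G k =
  (∃[ S ] (IsFPDS G S × ∣ S ∣ ≡ k)) ×
  (∀ S → IsFPDS G S → ∣ S ∣ ≤ k)

record _≅_ (G H : Graph) : Set where
  field
    to      : Vertex G → Vertex H
    from    : Vertex H → Vertex G
    to∘from : ∀ y → to (from y) ≡ y
    from∘to : ∀ x → from (to x) ≡ x
    pres    : ∀ u v → adj H (to u) (to v) ≡ adj G u v

K̄₂ : Graph
K̄₂ = record { order = 2 ; adj = λ _ _ → false ; sym = λ _ _ → refl ; irrefl = λ _ → refl }

emptyGraph : Graph
emptyGraph = record { order = 0 ; adj = λ () ; sym = λ () ; irrefl = λ () }

-- binary join: vertices of G are Fin (order G) embedded first,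
-- vertices of H after them
private
  jadj : ∀ {a b} → (Fin a → Fin a → Bool) → (Fin b → Fin b → Bool) →
         Fin a ⊎ Fin b → Fin a ⊎ Fin b → Bool
  jadj A B (inj₁ i) (inj₁ j) = A i j
  jadj A B (inj₂ i) (inj₂ j) = B i j
  jadj A B (inj₁ i) (inj₂ j) = true
  jadj A B (inj₂ i) (inj₁ j) = true

  jadj-sym : ∀ {a b} (A : Fin a → Fin a → Bool) (B : Fin b → Fin b → Bool) →
             (∀ u v → A u v ≡ A v u) → (∀ u v → B u v ≡ B v u) →
             ∀ x y → jadj A B x y ≡ jadj A B y x
  jadj-sym A B sA sB (inj₁ i) (inj₁ j) = sA i j
  jadj-sym A B sA sB (inj₂ i) (inj₂ j) = sB i j
  jadj-sym A B sA sB (inj₁ i) (inj₂ j) = refl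
  jadj-sym A B sA sB (inj₂ i) (inj₁ j) = refl

  jadj-irr : ∀ {a b} (A : Fin a → Fin a → Bool) (B : Fin b → Fin b → Bool) →
             (∀ v → A v v ≡ false) → (∀ v → B v v ≡ false) →
             ∀ x → jadj A B x x ≡ false
  jadj-irr A B iA iB (inj₁ i) = iA i
  jadj-irr A B iA iB (inj₂ i) = iB i

_∨ᵍ_ : Graph → Graph → Graph
G ∨ᵍ H = record
  { order  = order G + order H
  ; adj    = λ u v → jadj (adj G) (adj H) (splitAt (order G) u) (splitAt (order G) v)
  ; sym    = λ u v → jadj-sym (adj G) (adj H) (sym G) (sym H)
                       (splitAt (order G) u) (splitAt (order G) v)
  ; irrefl = λ v → jadj-irr (adj G) (adj H) (irrefl G) (irrefl H) (splitAt (order G) v)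
  }

-- G₁ ∨ G₂ ∨ ⋯ ∨ Gₙ  (right-nested; the join is associative up to isomorphism)
bigJoin : (n : ℕ) → (Fin n → Graph) → Graph
bigJoin zero    G = emptyGraph
bigJoin (suc n) G = G F.zero ∨ᵍ bigJoin n (λ i → G (F.suc i))

module Submission where

-- γ̄_p(H) = 0 means: H is nonempty and every nonempty vertex set of H is power
-- dominating; by monotonicity in the seed set this is equivalent to every
-- singleton being power dominating.  The join G₁ ∨ ⋯ ∨ Gₙ is analysed one
-- factor at a time through the notion of a *join factor* G of J: an induced copy
-- of G in J such that every vertex of J outside the copy sees the whole copy.
--
-- (⇐) Forward simulation: if e(x) ∈ T then e maps P^k_G({x}) into P^k_J(T),
--     since everything outside the copy already lies in N[T].  Hence a power
--     dominating singleton of a factor makes every seed set meeting it power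
--     dominating in J.  For a factor ≅ K̄₂ one outside vertex (available as
--     n ≥ 2 and every Gᵢ is nonempty) forces the second vertex in one step.
-- (⇒) Backward simulation: if {x} fails in a factor G, then P^k_J({e(x)}) ∩ G
--     ⊆ P^k_G({x}), unless an outside vertex forces in J.  That only happens
--     when P^k_G({x}) misses exactly one vertex w; w must then be isolated in G
--     (a neighbour would force it), and either G = {w, x} is K̄₂, or two further
--     vertices of G stop {e(w)} from being power dominating in J.

open import Defs
open import Data.Nat using (ℕ; _≤_; _<_; zero; suc; s≤s; _+_)
open import Data.Nat.Properties using (≤-reflexive)
open import Data.Fin using (Fin; splitAt; _↑ˡ_; _↑ʳ_; fromℕ<)
import Data.Fin as F
open import Data.Fin.Properties
  using (splitAt-↑ˡ; splitAt-↑ʳ; splitAt⁻¹-↑ˡ; splitAt⁻¹-↑ʳ; ↑ˡ-injective; ↑ʳ-injective; any?; all?)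
  renaming (_≟_ to _≟F_)
open import Data.Fin.Subset using (Subset; _∈_; ∣_∣; ⁅_⁆; ⊥)
open import Data.Fin.Subset.Properties
  using (_∈?_; x∈⁅x⁆; x∈⁅y⁆⇒x≡y; ∣⁅x⁆∣≡1; ∣⊥∣≡0; nonempty?; Empty-unique; ∉⊥)
open import Data.Bool using (true; false)
open import Data.Bool.Properties using (¬-not) renaming (_≟_ to _≟B_)
open import Data.Sum using (_⊎_; inj₁; inj₂)
open import Data.Product using (_×_; Σ; ∃-syntax; _,_; proj₁; proj₂)
open import Data.Empty using (⊥-elim) renaming (⊥ to Empty)
open import Relation.Nullary using (¬_; Dec; yes; no)
open import Relation.Nullary.Decidable using (¬?; _×-dec_; _⊎-dec_; _→-dec_)
open import Relation.Nullary.Negation using (¬¬-map)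
open import Relation.Binary.PropositionalEquality
  using (_≡_; _≢_; refl; trans; cong; subst) renaming (sym to ≡-sym)

InClosedNbhd? : ∀ G v u → Dec (InClosedNbhd G v u)
InClosedNbhd? G v u = (u ≟F v) ⊎-dec (adj G v u ≟B true)

InP? : ∀ G S i w → Dec (InP G S i w)
InP? G S zero    w = any? (λ v → (v ∈? S) ×-dec InClosedNbhd? G v w)
InP? G S (suc i) w =
  InP? G S i w ⊎-dec
  any? (λ v → InP? G S i v ×-dec
              (InClosedNbhd? G v w ×-dec ¬? (InP? G S i w)) ×-dec
              all? (λ u → InClosedNbhd? G v u →-dec ¬? (InP? G S i u) →-dec (u ≟F w)))

N[S]⊆Pᵏ : ∀ {G S w} → InP G S 0 w → ∀ k → InP G S k w
N[S]⊆Pᵏ p zero    = p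
N[S]⊆Pᵏ p (suc k) = inj₁ (N[S]⊆Pᵏ p k)

record JoinFactor (G J : Graph) : Set where
  field
    emb             : Vertex G → Vertex J
    emb-injective   : ∀ {x y} → emb x ≡ emb y → x ≡ y
    emb-adj         : ∀ x y → adj J (emb x) (emb y) ≡ adj G x y
    image-or-joined : ∀ v → (∃[ x ] v ≡ emb x) ⊎ (∀ x → Adj J v (emb x))

  nbhd-emb : ∀ {a b} → InClosedNbhd G a b → InClosedNbhd J (emb a) (emb b)
  nbhd-emb (inj₁ e) = inj₁ (cong emb e)
  nbhd-emb (inj₂ h) = inj₂ (trans (emb-adj _ _) h)

  nbhd-unemb : ∀ {a b} → InClosedNbhd J (emb a) (emb b) → InClosedNbhd G a b
  nbhd-unemb (inj₁ e) = inj₁ (emb-injective e)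
  nbhd-unemb (inj₂ h) = inj₂ (trans (≡-sym (emb-adj _ _)) h)

open JoinFactor

self-factor : ∀ G → JoinFactor G G
self-factor G = record
  { emb = λ v → v ; emb-injective = λ e → e ; emb-adj = λ _ _ → refl
  ; image-or-joined = λ v → inj₁ (v , refl) }

adj-↑ˡ↑ˡ : ∀ G H x y → adj (G ∨ᵍ H) (x ↑ˡ order H) (y ↑ˡ order H) ≡ adj G x y
adj-↑ˡ↑ˡ G H x y rewrite splitAt-↑ˡ (order G) x (order H) | splitAt-↑ˡ (order G) y (order H) = refl

adj-↑ʳ↑ʳ : ∀ G H x y → adj (G ∨ᵍ H) (order G ↑ʳ x) (order G ↑ʳ y) ≡ adj H x y
adj-↑ʳ↑ʳ G H x y rewrite splitAt-↑ʳ (order G) (order H) x | splitAt-↑ʳ (order G) (order H) y = refl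

adj-↑ˡ↑ʳ : ∀ G H x y → Adj (G ∨ᵍ H) (x ↑ˡ order H) (order G ↑ʳ y)
adj-↑ˡ↑ʳ G H x y rewrite splitAt-↑ˡ (order G) x (order H) | splitAt-↑ʳ (order G) (order H) y = refl

adj-↑ʳ↑ˡ : ∀ G H x y → Adj (G ∨ᵍ H) (order G ↑ʳ y) (x ↑ˡ order H)
adj-↑ʳ↑ˡ G H x y rewrite splitAt-↑ˡ (order G) x (order H) | splitAt-↑ʳ (order G) (order H) y = refl

↑ˡ-or-↑ʳ : ∀ m n (v : Fin (m + n)) → (∃[ a ] v ≡ a ↑ˡ n) ⊎ (∃[ b ] v ≡ m ↑ʳ b)
↑ˡ-or-↑ʳ m n v with splitAt m v in eq
... | inj₁ a = inj₁ (a , ≡-sym (splitAt⁻¹-↑ˡ eq))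
... | inj₂ b = inj₂ (b , ≡-sym (splitAt⁻¹-↑ʳ eq))

left-factor : ∀ G H → JoinFactor G (G ∨ᵍ H)
left-factor G H = record
  { emb = λ x → x ↑ˡ order H ; emb-injective = ↑ˡ-injective (order H) _ _
  ; emb-adj = adj-↑ˡ↑ˡ G H ; image-or-joined = image-or-joined′ }
  where
  image-or-joined′ : ∀ v → (∃[ x ] v ≡ x ↑ˡ order H) ⊎ (∀ x → Adj (G ∨ᵍ H) v (x ↑ˡ order H))
  image-or-joined′ v with ↑ˡ-or-↑ʳ (order G) (order H) v
  ... | inj₁ (a , refl) = inj₁ (a , refl)
  ... | inj₂ (b , refl) = inj₂ (λ x → adj-↑ʳ↑ˡ G H x b)

right-factor : ∀ G H K → JoinFactor K H → JoinFactor K (G ∨ᵍ H)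
right-factor G H K f = record
  { emb = λ x → order G ↑ʳ emb f x
  ; emb-injective = λ e → emb-injective f (↑ʳ-injective (order G) _ _ e)
  ; emb-adj = λ x y → trans (adj-↑ʳ↑ʳ G H (emb f x) (emb f y)) (emb-adj f x y)
  ; image-or-joined = image-or-joined′ }
  where
  image-or-joined′ : ∀ v → (∃[ x ] v ≡ order G ↑ʳ emb f x) ⊎
                           (∀ x → Adj (G ∨ᵍ H) v (order G ↑ʳ emb f x))
  image-or-joined′ v with ↑ˡ-or-↑ʳ (order G) (order H) v
  ... | inj₁ (a , refl) = inj₂ (λ x → adj-↑ˡ↑ʳ G H a (emb f x))
  ... | inj₂ (b , refl) with image-or-joined f b
  ...   | inj₁ (x , refl) = inj₁ (x , refl)
  ...   | inj₂ joined = inj₂ (λ x → trans (adj-↑ʳ↑ʳ G H b (emb f x)) (joined x))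

factor : ∀ n (G : Fin n → Graph) i → JoinFactor (G i) (bigJoin n G)
factor (suc n) G F.zero    = left-factor (G F.zero) (bigJoin n (λ i → G (F.suc i)))
factor (suc n) G (F.suc i) =
  right-factor (G F.zero) (bigJoin n (λ i → G (F.suc i))) (G (F.suc i)) (factor n (λ i → G (F.suc i)) i)

covered : ∀ n (G : Fin n → Graph) v → ∃[ i ] ∃[ x ] v ≡ emb (factor n G i) x
covered (suc n) G v with ↑ˡ-or-↑ʳ (order (G F.zero)) (order (bigJoin n (λ i → G (F.suc i)))) v
... | inj₁ (a , refl) = F.zero , a , refl
... | inj₂ (b , refl) with covered n (λ i → G (F.suc i)) b
...   | i , x , refl = F.suc i , x , refl

joined-vertex : ∀ n (G : Fin n → Graph) → 2 ≤ n → (∀ i → 0 < order (G i)) →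
                ∀ i → ∃[ o ] (∀ z → Adj (bigJoin n G) o (emb (factor n G i) z))
joined-vertex (suc zero) G (s≤s ()) pos F.zero
joined-vertex (suc (suc n)) G _ pos F.zero =
  order (G F.zero) ↑ʳ (fromℕ< (pos (F.suc F.zero)) ↑ˡ _) ,
  λ z → adj-↑ʳ↑ˡ (G F.zero) (bigJoin (suc n) (λ i → G (F.suc i))) z _
joined-vertex (suc (suc n)) G _ pos (F.suc i) =
  fromℕ< (pos F.zero) ↑ˡ _ ,
  λ z → adj-↑ˡ↑ʳ (G F.zero) (bigJoin (suc n) (λ i → G (F.suc i))) (fromℕ< (pos F.zero)) _

module Forward {G J : Graph} (f : JoinFactor G J) (x : Vertex G)
               (T : Subset (order J)) (x∈T : emb f x ∈ T) where

  joined-in-N[T] : ∀ u → (∀ z → Adj J u (emb f z)) → InP J T 0 u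
  joined-in-N[T] u joined = emb f x , x∈T , inj₂ (trans (sym J (emb f x) u) (joined x))

  forward : ∀ k y → InP G ⁅ x ⁆ k y → InP J T k (emb f y)
  forward zero y (v , v∈⁅x⁆ , nb) with x∈⁅y⁆⇒x≡y x v∈⁅x⁆
  ... | refl = emb f x , x∈T , nbhd-emb f nb
  forward (suc k) y (inj₁ p) = inj₁ (forward k y p)
  forward (suc k) y (inj₂ (v , vP , (nb , _) , unique)) with InP? J T k (emb f y)
  ... | yes yP = inj₁ yP
  ... | no ¬yP = inj₂ (emb f v , forward k v vP , (nbhd-emb f nb , ¬yP) , uniqueJ)
    where
    -- outside vertices are already monitored, so the forced vertex is unique in J too
    uniqueJ : ∀ u → InClosedNbhd J (emb f v) u → ¬ InP J T k u → u ≡ emb f y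
    uniqueJ u nbu ¬uP with image-or-joined f u
    ... | inj₁ (y′ , refl) = cong (emb f) (unique y′ (nbhd-unemb f nbu) (λ p → ¬uP (forward k y′ p)))
    ... | inj₂ joined = ⊥-elim (¬uP (N[S]⊆Pᵏ (joined-in-N[T] u joined) k))

  forward-PDS : IsPDS G ⁅ x ⁆ → IsPDS J T
  forward-PDS pds u with image-or-joined f u
  ... | inj₁ (y , refl) = proj₁ (pds y) , forward (proj₁ (pds y)) y (proj₂ (pds y))
  ... | inj₂ joined = 0 , joined-in-N[T] u joined

PDS-from-member : ∀ {H x S} → IsPDS H ⁅ x ⁆ → x ∈ S → IsPDS H S
PDS-from-member {H} {x} {S} pds x∈S = Forward.forward-PDS (self-factor H) x S x∈S pds

empty-is-FPDS : ∀ H → Vertex H → IsFPDS H ⊥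
empty-is-FPDS H v pds = unmonitored (proj₁ (pds v)) v (proj₂ (pds v))
  where
  unmonitored : ∀ k w → ¬ InP H ⊥ k w
  unmonitored zero    w (u , u∈⊥ , _)     = ∉⊥ u∈⊥
  unmonitored (suc k) w (inj₁ p)          = unmonitored k w p
  unmonitored (suc k) w (inj₂ (u , p , _)) = unmonitored k u p

FPDS-zero-intro : ∀ H → Vertex H → (∀ S x → x ∈ S → ¬ ¬ IsPDS H S) → FPDSNumber H 0
FPDS-zero-intro H v never-fails = (⊥ , empty-is-FPDS H v , ∣⊥∣≡0 (order H)) , bound
  where
  bound : ∀ S → IsFPDS H S → ∣ S ∣ ≤ 0
  bound S fails with nonempty? S
  ... | yes (x , x∈S) = ⊥-elim (never-fails S x x∈S fails)
  ... | no empty = subst (λ s → ∣ s ∣ ≤ 0) (≡-sym (Empty-unique empty)) (≤-reflexive (∣⊥∣≡0 (order H)))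

FPDS-zero-singletons : ∀ {H} → FPDSNumber H 0 → ∀ x → ¬ ¬ IsPDS H ⁅ x ⁆
FPDS-zero-singletons (_ , bound) x fails with subst (_≤ 0) (∣⁅x⁆∣≡1 x) (bound ⁅ x ⁆ fails)
... | ()

FPDS-zero-from-singletons : ∀ H → Vertex H → (∀ x → ¬ ¬ IsPDS H ⁅ x ⁆) → FPDSNumber H 0
FPDS-zero-from-singletons H v singletons =
  FPDS-zero-intro H v (λ S x x∈S → ¬¬-map (λ pds → PDS-from-member pds x∈S) (singletons x))

Fin2-third : ∀ {a b c : Fin 2} → a ≢ c → b ≢ c → a ≡ b
Fin2-third {F.zero}        {F.zero}        _ _ = refl
Fin2-third {F.suc F.zero}  {F.suc F.zero}  _ _ = refl
Fin2-third {F.zero}        {F.suc F.zero}  {F.zero}       a≢c _   = ⊥-elim (a≢c refl)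
Fin2-third {F.zero}        {F.suc F.zero}  {F.suc F.zero} _   b≢c = ⊥-elim (b≢c refl)
Fin2-third {F.suc F.zero}  {F.zero}        {F.zero}       _   b≢c = ⊥-elim (b≢c refl)
Fin2-third {F.suc F.zero}  {F.zero}        {F.suc F.zero} a≢c _   = ⊥-elim (a≢c refl)

K̄₂-third : ∀ {G} → G ≅ K̄₂ → ∀ {x y y′} → y ≢ x → y′ ≢ x → y ≡ y′
K̄₂-third φ {x} {y} {y′} y≢x y′≢x =
  trans (≡-sym (from∘to y)) (trans (cong from (Fin2-third (to-≢ y≢x) (to-≢ y′≢x))) (from∘to y′))
  where
  open _≅_ φ
  to-≢ : ∀ {a} → a ≢ x → to a ≢ to x
  to-≢ {a} a≢x e = a≢x (trans (≡-sym (from∘to a)) (trans (cong from e) (from∘to x)))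

-- A join factor isomorphic to K̄₂ that some vertex o sees entirely: any seed
-- set containing one of its two vertices is power dominating, since o then
-- forces the other one.
K̄₂-factor-PDS : ∀ {G J} (f : JoinFactor G J) → G ≅ K̄₂ → ∃[ o ] (∀ z → Adj J o (emb f z)) →
                ∀ x T → emb f x ∈ T → IsPDS J T
K̄₂-factor-PDS {G} {J} f φ (o , o-joined) x T x∈T u with image-or-joined f u
... | inj₂ joined = 0 , joined-in-N[T] u joined
  where open Forward f x T x∈T
... | inj₁ (y , refl) with y ≟F x | InP? J T 0 (emb f y)
...   | yes refl | _      = 0 , emb f x , x∈T , inj₁ refl
...   | no _     | yes yP = 0 , yP
...   | no y≢x   | no ¬yP =
  1 , inj₂ (o , joined-in-N[T] o o-joined , (inj₂ (o-joined y) , ¬yP) , unique)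
  where
  open Forward f x T x∈T
  unique : ∀ u → InClosedNbhd J o u → ¬ InP J T 0 u → u ≡ emb f y
  unique u _ ¬uP with image-or-joined f u
  ... | inj₂ joined = ⊥-elim (¬uP (joined-in-N[T] u joined))
  ... | inj₁ (y′ , refl) with y′ ≟F x
  ...   | yes refl = ⊥-elim (¬uP (emb f x , x∈T , inj₁ refl))
  ...   | no y′≢x  = cong (emb f) (K̄₂-third φ y′≢x y≢x)

seeded-factor-PDS : ∀ {G J} (f : JoinFactor G J) → FPDSNumber G 0 ⊎ G ≅ K̄₂ →
                    ∃[ o ] (∀ z → Adj J o (emb f z)) → ∀ {x T} → emb f x ∈ T → ¬ ¬ IsPDS J T
seeded-factor-PDS f (inj₁ zero-G) _ {x} {T} x∈T =
  ¬¬-map (Forward.forward-PDS f x T x∈T) (FPDS-zero-singletons zero-G x)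
seeded-factor-PDS f (inj₂ φ) o {x} {T} x∈T fails = fails (K̄₂-factor-PDS f φ o x T x∈T)

EdgelessPair : Graph → Set
EdgelessPair G = Σ (Vertex G) λ a → Σ (Vertex G) λ b →
  (a ≢ b) × (∀ v → v ≡ a ⊎ v ≡ b) × (∀ u v → adj G u v ≡ false)

edgelessPair? : ∀ G → Dec (EdgelessPair G)
edgelessPair? G =
  any? λ a → any? λ b → ¬? (a ≟F b) ×-dec all? (λ v → (v ≟F a) ⊎-dec (v ≟F b))
                        ×-dec all? (λ u → all? (λ v → adj G u v ≟B false))

edgelessPair⇒≅K̄₂ : ∀ {G} → EdgelessPair G → G ≅ K̄₂
edgelessPair⇒≅K̄₂ {G} (a , b , a≢b , a-or-b , edgeless) = record
  { to = to ; from = from ; to∘from = to∘from ; from∘to = from∘to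
  ; pres = λ u v → ≡-sym (edgeless u v) }
  where
  to : Vertex G → Fin 2
  to v with v ≟F a
  ... | yes _ = F.zero
  ... | no _  = F.suc F.zero
  from : Fin 2 → Vertex G
  from F.zero    = a
  from (F.suc _) = b
  to∘from : ∀ y → to (from y) ≡ y
  to∘from F.zero with a ≟F a
  ... | yes _   = refl
  ... | no a≢a  = ⊥-elim (a≢a refl)
  to∘from (F.suc F.zero) with b ≟F a
  ... | yes b≡a = ⊥-elim (a≢b (≡-sym b≡a))
  ... | no _    = refl
  from∘to : ∀ v → from (to v) ≡ v
  from∘to v with v ≟F a
  ... | yes v≡a = ≡-sym v≡a
  ... | no v≢a with a-or-b v
  ...   | inj₁ v≡a = ⊥-elim (v≢a v≡a)
  ...   | inj₂ v≡b = ≡-sym v≡b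

-- If P^j(S) misses only w and w has a neighbour y, then y forces w, so S is
-- power dominating.
single-gap-closes : ∀ G S j w y → (∀ u → u ≢ w → InP G S j u) → Adj G w y → IsPDS G S
single-gap-closes G S j w y gap w~y v with v ≟F w
... | no v≢w = j , gap v v≢w
... | yes refl with InP? G S j v
...   | yes vP = j , vP
...   | no ¬vP = suc j , inj₂ (y , gap y y≢w , (inj₂ (trans (sym G y w) w~y) , ¬vP) , unique)
  where
  y≢w : y ≢ w
  y≢w refl with trans (≡-sym w~y) (irrefl G w)
  ... | ()
  unique : ∀ u → InClosedNbhd G y u → ¬ InP G S j u → u ≡ w
  unique u _ ¬uP with u ≟F w
  ... | yes u≡w = u≡w
  ... | no u≢w  = ⊥-elim (¬uP (gap u u≢w))

gap-isolated : ∀ G S j w → ¬ IsPDS G S → (∀ u → u ≢ w → InP G S j u) → ∀ y → adj G w y ≡ false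
gap-isolated G S j w fails gap y = ¬-not (λ w~y → fails (single-gap-closes G S j w y gap w~y))

-- A vertex w isolated in a join factor G with two further vertices a ≠ b: from
-- {emb w}, no vertex of J ever forces into the copy of G (an outside vertex sees
-- both a and b), so w is the only monitored vertex of G and {emb w} fails in J.
isolated-seed-fails : ∀ {G J} (f : JoinFactor G J) w → (∀ y → adj G w y ≡ false) →
                      ∀ a b → a ≢ w → b ≢ w → a ≢ b → ¬ IsPDS J ⁅ emb f w ⁆
isolated-seed-fails {G} {J} f w isolated a b a≢w b≢w a≢b pds =
  a≢w (only-w (proj₁ (pds (emb f a))) a (proj₂ (pds (emb f a))))
  where
  nbhd-w : ∀ {y} → InClosedNbhd G w y → y ≡ w
  nbhd-w (inj₁ e) = e
  nbhd-w {y} (inj₂ w~y) with trans (≡-sym (isolated y)) w~y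
  ... | ()
  only-w : ∀ k y → InP J ⁅ emb f w ⁆ k (emb f y) → y ≡ w
  only-w zero y (v , v∈⁅w⁆ , nb) with x∈⁅y⁆⇒x≡y (emb f w) v∈⁅w⁆
  ... | refl = nbhd-w (nbhd-unemb f nb)
  only-w (suc k) y (inj₁ p) = only-w k y p
  only-w (suc k) y (inj₂ (v , vP , (nb , _) , unique)) with image-or-joined f v
  ... | inj₁ (z , refl) with only-w k z vP
  ...   | refl = nbhd-w (nbhd-unemb f nb)
  only-w (suc k) y (inj₂ (v , vP , (nb , _) , unique)) | inj₂ joined =
    ⊥-elim (a≢b (emb-injective f (trans (forced a a≢w) (≡-sym (forced b b≢w)))))
    where
    forced : ∀ c → c ≢ w → emb f c ≡ emb f y
    forced c c≢w = unique (emb f c) (inj₂ (joined c)) (λ p → c≢w (only-w k c p))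

module Backward {G J : Graph} (f : JoinFactor G J) (singletons-J : ∀ v → ¬ ¬ IsPDS J ⁅ v ⁆)
                (not-K̄₂ : ¬ EdgelessPair G) (x : Vertex G) (x-fails : ¬ IsPDS G ⁅ x ⁆) where

  open Forward f x ⁅ emb f x ⁆ (x∈⁅x⁆ (emb f x))

  -- A vertex w ≠ x isolated in G cannot exist: with two further vertices,
  -- {emb w} would fail in J; otherwise G = {w, x} would be K̄₂.
  no-isolated-vertex : ∀ w → (∀ y → adj G w y ≡ false) → w ≢ x → Empty
  no-isolated-vertex w isolated w≢x
    with any? (λ a → any? (λ b → ¬? (a ≟F w) ×-dec ¬? (b ≟F w) ×-dec ¬? (a ≟F b)))
  ... | yes (a , b , a≢w , b≢w , a≢b) =
    singletons-J (emb f w) (isolated-seed-fails f w isolated a b a≢w b≢w a≢b)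
  ... | no no-pair = not-K̄₂ (w , x , w≢x , w-or-x , edgeless)
    where
    w-or-x : ∀ v → v ≡ w ⊎ v ≡ x
    w-or-x v with v ≟F w | v ≟F x
    ... | yes v≡w | _       = inj₁ v≡w
    ... | no _    | yes v≡x = inj₂ v≡x
    ... | no v≢w  | no v≢x  = ⊥-elim (no-pair (v , x , v≢w , (λ x≡w → w≢x (≡-sym x≡w)) , v≢x))
    edgeless : ∀ u v → adj G u v ≡ false
    edgeless u v with w-or-x u | w-or-x v
    ... | inj₁ refl | _         = isolated v
    ... | inj₂ refl | inj₁ refl = trans (sym G u w) (isolated u)
    ... | inj₂ refl | inj₂ refl = irrefl G u

  no-single-gap : ∀ w j → (∀ u → u ≢ w → InP G ⁅ x ⁆ j u) → ¬ InP G ⁅ x ⁆ j w → Empty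
  no-single-gap w j gap ¬wP = no-isolated-vertex w (gap-isolated G ⁅ x ⁆ j w x-fails gap) w≢x
    where
    w≢x : w ≢ x
    w≢x refl = ¬wP (N[S]⊆Pᵏ (x , x∈⁅x⁆ x , inj₁ refl) j)

  backward : ∀ k y → InP J ⁅ emb f x ⁆ k (emb f y) → InP G ⁅ x ⁆ k y
  backward zero y (v , v∈⁅x⁆ , nb) with x∈⁅y⁆⇒x≡y (emb f x) v∈⁅x⁆
  ... | refl = x , x∈⁅x⁆ x , nbhd-unemb f nb
  backward (suc k) y (inj₁ p) = inj₁ (backward k y p)
  backward (suc k) y (inj₂ (v , vP , (nb , ¬yP) , unique)) with image-or-joined f v
  ... | inj₁ (z , refl) =
    inj₂ (z , backward k z vP , (nbhd-unemb f nb , (λ p → ¬yP (forward k y p))) , uniqueG)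
    where
    uniqueG : ∀ u → InClosedNbhd G z u → ¬ InP G ⁅ x ⁆ k u → u ≡ y
    uniqueG u nbu ¬uP = emb-injective f (unique (emb f u) (nbhd-emb f nbu) (λ p → ¬uP (backward k u p)))
  ... | inj₂ joined = ⊥-elim (no-single-gap y k gap (λ p → ¬yP (forward k y p)))
    where
    -- v sees the whole copy of G, so y is the only vertex of G it could force
    gap : ∀ u → u ≢ y → InP G ⁅ x ⁆ k u
    gap u u≢y with InP? G ⁅ x ⁆ k u
    ... | yes uP = uP
    ... | no ¬uP = ⊥-elim (u≢y (emb-injective f
                    (unique (emb f u) (inj₂ (joined u)) (λ p → ¬uP (backward k u p)))))

  absurd : Empty
  absurd = singletons-J (emb f x) λ pds →
    x-fails (λ y → proj₁ (pds (emb f y)) , backward (proj₁ (pds (emb f y))) y (proj₂ (pds (emb f y))))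

factor-singletons : ∀ {G J} (f : JoinFactor G J) → (∀ v → ¬ ¬ IsPDS J ⁅ v ⁆) →
                    ¬ EdgelessPair G → ∀ x → ¬ ¬ IsPDS G ⁅ x ⁆
factor-singletons f singletons-J not-K̄₂ x x-fails = Backward.absurd f singletons-J not-K̄₂ x x-fails

lemma4 : (n : ℕ) → 2 ≤ n → (G : Fin n → Graph) → (∀ i → 0 < order (G i)) →
    (FPDSNumber (bigJoin n G) 0 → (∀ i → FPDSNumber (G i) 0 ⊎ G i ≅ K̄₂)) ×
    ((∀ i → FPDSNumber (G i) 0 ⊎ G i ≅ K̄₂) → FPDSNumber (bigJoin n G) 0)
lemma4 (suc m) 2≤n G pos = necessity , sufficiency
  where
  n = suc m
  J = bigJoin n G

  necessity : FPDSNumber J 0 → ∀ i → FPDSNumber (G i) 0 ⊎ G i ≅ K̄₂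
  necessity zero-J i with edgelessPair? (G i)
  ... | yes pair  = inj₂ (edgelessPair⇒≅K̄₂ pair)
  ... | no ¬pair = inj₁ (FPDS-zero-from-singletons (G i) (fromℕ< (pos i))
                          (factor-singletons (factor n G i) (FPDS-zero-singletons zero-J) ¬pair))

  sufficiency : (∀ i → FPDSNumber (G i) 0 ⊎ G i ≅ K̄₂) → FPDSNumber J 0
  sufficiency good = FPDS-zero-intro J (emb (factor n G F.zero) (fromℕ< (pos F.zero))) never-fails
    where
    never-fails : ∀ S v → v ∈ S → ¬ ¬ IsPDS J S
    never-fails S v v∈S with covered n G v
    ... | i , x , refl = seeded-factor-PDS (factor n G i) (good i) (joined-vertex n G 2≤n pos i) v∈S
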